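{- Let $k,n$ be positive integers and $\chi$ a simple character of a subgroup $G\subseteq S_k$. Then, in coordinates $(x_z)_{z\in[n]^k}$ of $\mathbb{P}((\mathbb{C}^n)^{\otimes k})$ with respect to the basis $\{e_z\}$, the set $\mathrm{Im}(\widehat{P}^{(n)}_\chi)$ is described by the parametric equations $$x_z=\chi_{z,(1,\dots,k)}(A),\qquad z\in[n]^k,$$ where $A=(a_{ij})\in\mathrm{Mat}_{n,k}(\mathbb{C})$ is a matrix of parameters none of whose columns is the zero vector; that is, $\mathrm{Im}(\widehat{P}^{(n)}_\chi)$ is the set of points $\big[\sum_{z\in[n]^k}\chi_{z,(1,\dots,k)}(A)e_z\big]$ for such matrices $A$ for which this vector is nonzero.
   Context: $V=\mathbb{C}^n$ with basis $e_1,\dots,e_n$; $e_x=e_{x_1}\otimes\cdots\otimes e_{x_k}$ for $x\in[n]^k$. $S_k$ acts on $[n]^k$ by $w(x)=(x_{w^{ -1}(1)},\dots,x_{w^{ -1}(k)})$ and on $V^{\otimes k}$ by $w(e_x)=e_{w(x)}$; this gives an algebra morphism $\mathbb{C}[S_k]\to\mathrm{End}(V^{\otimes k})$, $P\mapsto P^{(n)}$. $P_\chi=\frac{\chi(e)}{|G|}\sum_{g\in G}\chi(g^{ -1})g$. With $\mathrm{Seg}(k,n)=\{[v_1\otimes\cdots\otimes v_k]:v_i\in V\setminus\{0\}\}$, the map $\widehat{P}^{(n)}_\chi:\mathrm{Seg}(k,n)\setminus\mathbb{P}(\ker P^{(n)}_\chi)\to\mathbb{P}(V^{\otimes k})$ sends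 $[v_1\otimes\cdots\otimes v_k]$ to $[P^{(n)}_\chi(v_1\otimes\cdots\otimes v_k)]$. For $M\in\mathrm{Mat}_{m,n'}(\mathbb{C})$, $(M^{\otimes k})_{x,y}=\prod_{i=1}^k M_{x_i,y_i}$ ($x\in[m]^k,y\in[n']^k$), and $\chi_{x,y}(M)=\sum_{g\in G}\chi(g)(M^{\otimes k})_{g(x),y}$. -}

module Defs where

open import Level using (Level; _⊔_) renaming (suc to lsuc)
open import Data.Nat as ℕ using (ℕ; zero; suc; _<_)
open import Data.Fin using (Fin; _≟_)
open import Data.List using (List; []; _∷_; length; foldr; map)
open import Data.List.Relation.Unary.Any using (Any)
open import Data.List.Relation.Unary.AllPairs using (AllPairs)
open import Data.Product using (Σ; _×_; ∃; ∃-syntax)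
open import Relation.Nullary using (¬_; yes; no)
open import Algebra.Bundles using (CommutativeRing)
open import Data.Fin.Permutation as Perm
  using (Permutation′; _⟨$⟩ʳ_; _⟨$⟩ˡ_; _∘ₚ_; flip)
  renaming (id to idₚ)

-- The paper works over ℂ; agda-stdlib has no ℂ,
-- so we work over an arbitrary algebraically closed field of
-- characteristic zero (ℂ is one), given as a commutative ring together
-- with inverses, 1 ≠ 0, characteristic 0 and algebraic closedness.

module RingHelpers {c ℓ : Level} (R : CommutativeRing c ℓ) where
  open CommutativeRing R

  ℕ→K : ℕ → Carrier
  ℕ→K zero    = 0#
  ℕ→K (suc n) = 1# + ℕ→K n

  pow : Carrier → ℕ → Carrier
  pow x zero    = 1#
  pow x (suc n) = x * pow x n

  -- value at x of the monic polynomial  c₀ + c₁ x + … + c_{m-1} x^{m-1} + x^m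
  -- where cs = c₀ ∷ … ∷ c_{m-1}
  evalMonicAux : ℕ → List Carrier → Carrier → Carrier
  evalMonicAux i []       x = pow x i
  evalMonicAux i (c ∷ cs) x = c * pow x i + evalMonicAux (suc i) cs x

  evalMonic : List Carrier → Carrier → Carrier
  evalMonic = evalMonicAux 0

record ACF₀ (c ℓ : Level) : Set (lsuc (c ⊔ ℓ)) where
  field
    cring : CommutativeRing c ℓ
  open CommutativeRing cring public
  open RingHelpers cring public
  field
    inv      : Carrier → Carrier
    inv-r    : ∀ x → ¬ (x ≈ 0#) → x * inv x ≈ 1#
    1≉0      : ¬ (1# ≈ 0#)

  field
    char0    : ∀ n → ¬ (ℕ→K (suc n) ≈ 0#)
    -- every monic polynomial of degree ≥ 1 has a root
    algClosed : ∀ (c : Carrier) (cs : List Carrier) →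
                ∃[ x ] (evalMonic (c ∷ cs) x ≈ 0#)

-- An element w of S_k is a Permutation′ k, acting on
-- Fin k by w ⟨$⟩ʳ_.  The product g·h ("first h, then g") is h ∘ₚ g.

_∈ₚ_ : ∀ {k} → Permutation′ k → List (Permutation′ k) → Set
g ∈ₚ xs = Any (λ h → h Perm.≈ g) xs

record Subgroup (k : ℕ) : Set where
  field
    elems   : List (Permutation′ k)
    nodup   : AllPairs (λ g h → ¬ (g Perm.≈ h)) elems
    has-id  : idₚ ∈ₚ elems
    closed· : ∀ {g h} → g ∈ₚ elems → h ∈ₚ elems → (h ∘ₚ g) ∈ₚ elems
    closed⁻ : ∀ {g} → g ∈ₚ elems → flip g ∈ₚ elems

  order : ℕ
  order = length elems

module _ {c ℓ : Level} (F : ACF₀ c ℓ) where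
  open ACF₀ F

  ΣFin : (n : ℕ) → (Fin n → Carrier) → Carrier
  ΣFin zero    f = 0#
  ΣFin (suc n) f = f Fin.zero + ΣFin n (λ i → f (Fin.suc i))
    where import Data.Fin as Fin

  ΠFin : (n : ℕ) → (Fin n → Carrier) → Carrier
  ΠFin zero    f = 1#
  ΠFin (suc n) f = f Fin.zero * ΠFin n (λ i → f (Fin.suc i))
    where import Data.Fin as Fin

  ΣList : ∀ {a} {A : Set a} → List A → (A → Carrier) → Carrier
  ΣList xs f = foldr (λ x s → f x + s) 0# xs

  Mat : ℕ → ℕ → Set c
  Mat m n = Fin m → Fin n → Carrier

  _·M_ : ∀ {m n p} → Mat m n → Mat n p → Mat m p
  _·M_ {n = n} A B i j = ΣFin n (λ l → A i l * B l j)

  _≈M_ : ∀ {m n} → Mat m n → Mat m n → Set ℓ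
  A ≈M B = ∀ i j → A i j ≈ B i j

  idM : ∀ {d} → Mat d d
  idM i j with i ≟ j
  ... | yes _ = 1#
  ... | no  _ = 0#

  trace : ∀ {d} → Mat d d → Carrier
  trace {d} A = ΣFin d (λ i → A i i)


  record IsRep {k d : ℕ} (G : Subgroup k)
               (ρ : Permutation′ k → Mat d d) : Set (c ⊔ ℓ) where
    open Subgroup G
    field
      rep-id  : ρ idₚ ≈M idM
      rep-mul : ∀ {g h} → g ∈ₚ elems → h ∈ₚ elems →
                ρ (h ∘ₚ g) ≈M _·M_ (ρ g) (ρ h)
      rep-resp : ∀ {g h} → g ∈ₚ elems → g Perm.≈ h → ρ g ≈M ρ h

  LinIndepCols : ∀ {d r} → Mat d r → Set (c ⊔ ℓ)
  LinIndepCols {d} {r} B =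
    ∀ (a : Fin r → Carrier) →
      (∀ i → ΣFin r (λ j → B i j * a j) ≈ 0#) → ∀ j → a j ≈ 0#

  -- ρ is irreducible: d ≥ 1 and there is no G-invariant subspace of
  -- dimension r with 0 < r < d (subspace = column span of a d×r matrix
  -- with linearly independent columns).
  IsIrreducible : ∀ {k d} → Subgroup k → (Permutation′ k → Mat d d) →
                  Set (c ⊔ ℓ)
  IsIrreducible {k} {d} G ρ =
    (0 < d) ×
    (∀ (r : ℕ) → 0 < r → r < d → (B : Mat d r) → LinIndepCols B →
       ¬ (∀ {g} → g ∈ₚ Subgroup.elems G →
            ∃[ C ] (_·M_ (ρ g) B ≈M _·M_ B C)))

  -- χ is a simple character of G: the character of an irreducible
  -- representation of G over F (χ is only relevant on G).
  IsSimpleCharacter : ∀ {k} → Subgroup k → (Permutation′ k → Carrier) →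
                      Set (c ⊔ ℓ)
  IsSimpleCharacter {k} G χ =
    Σ ℕ λ d → Σ (Permutation′ k → Mat d d) λ ρ →
      IsRep G ρ × IsIrreducible G ρ ×
      (∀ {g} → g ∈ₚ Subgroup.elems G → χ g ≈ trace (ρ g))


  Index : ℕ → ℕ → Set
  Index n k = Fin k → Fin n

  -- an element of (F^n)^{⊗k}, by its coordinates in the basis e_x
  Tensor : ℕ → ℕ → Set c
  Tensor n k = Index n k → Carrier

  actIdx : ∀ {n k} → Permutation′ k → Index n k → Index n k
  actIdx w x i = x (w ⟨$⟩ˡ i)

  -- w acting on tensors: w(e_x) = e_{w(x)}, i.e. (w T)(y) = T(w⁻¹(y))
  actT : ∀ {n k} → Permutation′ k → Tensor n k → Tensor n k
  actT w T y = T (actIdx (flip w) y)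

  -- v₁ ⊗ ⋯ ⊗ v_k where v_i is the i-th column of A ∈ Mat_{n,k}
  simpleTensor : ∀ {n k} → Mat n k → Tensor n k
  simpleTensor {n} {k} A x = ΠFin k (λ i → A (x i) i)

  Pχ : ∀ {n k} → Subgroup k → (Permutation′ k → Carrier) →
       Tensor n k → Tensor n k
  Pχ G χ T y =
    (χ idₚ * inv (ℕ→K (Subgroup.order G))) *
    ΣList (Subgroup.elems G) (λ g → χ (flip g) * actT g T y)

  tensorPowEntry : ∀ {m n' k} → Mat m n' → Index m k → Index n' k → Carrier
  tensorPowEntry {k = k} M x y = ΠFin k (λ i → M (x i) (y i))

  χEntry : ∀ {m n' k} → Subgroup k → (Permutation′ k → Carrier) →
           Mat m n' → Index m k → Index n' k → Carrier
  χEntry G χ M x y =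
    ΣList (Subgroup.elems G) (λ g → χ g * tensorPowEntry M (actIdx g x) y)

  param : ∀ {n k} → Subgroup k → (Permutation′ k → Carrier) →
          Mat n k → Tensor n k
  param G χ A z = χEntry G χ A z (λ i → i)

  IsZeroT : ∀ {n k} → Tensor n k → Set ℓ
  IsZeroT T = ∀ z → T z ≈ 0#

  NonzeroCols : ∀ {n k} → Mat n k → Set ℓ
  NonzeroCols {n} {k} A = ∀ (i : Fin k) → ¬ (∀ (j : Fin n) → A j i ≈ 0#)

  SameProjPoint : ∀ {n k} → Tensor n k → Tensor n k → Set (c ⊔ ℓ)
  SameProjPoint T U = ∃[ s ] (¬ (s ≈ 0#) × (∀ z → T z ≈ s * U z))

  InImage : ∀ {n k} → Subgroup k → (Permutation′ k → Carrier) →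
            Tensor n k → Set (c ⊔ ℓ)
  InImage G χ T =
    ∃[ A ] (NonzeroCols A × ¬ IsZeroT (Pχ G χ (simpleTensor A)) ×
            SameProjPoint T (Pχ G χ (simpleTensor A)))

  InParamSet : ∀ {n k} → Subgroup k → (Permutation′ k → Carrier) →
               Tensor n k → Set (c ⊔ ℓ)
  InParamSet G χ T =
    ∃[ A ] (NonzeroCols A × ¬ IsZeroT (param G χ A) ×
            SameProjPoint T (param G χ A))

-- Write T_A := v₁ ⊗ ⋯ ⊗ v_k for the columns v_i of A.  Expanding P_χ(T_A)
-- in the basis e_z gives (χ(e)/|G|) Σ_{g∈G} χ(g⁻¹) (A^{⊗k})_{g⁻¹(z),(1,…,k)},
-- and reindexing the sum by g ↦ g⁻¹, a bijection of G, turns it into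
-- (χ(e)/|G|) χ_{z,(1,…,k)}(A).  Since χ(e) = dim ρ and |G| are nonzero in
-- characteristic 0, P_χ(T_A) and the parametrised vector are proportional,
-- hence define the same projective point (and vanish together).
module Submission where

open import Defs
open import Level using (Level; 0ℓ)
open import Data.Nat as ℕ using (ℕ; _<_)
open import Data.Product using (_×_; _,_)
open import Data.Fin as Fin using (Fin; _≟_)
open import Data.Fin.Permutation as Perm
  using (Permutation′; _⟨$⟩ʳ_; _⟨$⟩ˡ_; flip; inverseˡ; inverseʳ)
  renaming (id to idₚ)
open import Data.List using (List; []; _∷_; _++_; map; foldr; length)
open import Data.List.Relation.Unary.Any as Any using (Any; here; there)
import Data.List.Relation.Unary.AllPairs as AllPairs
open import Data.List.Relation.Binary.Pointwise using ([]; _∷_)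
open import Data.List.Membership.Setoid.Properties
  using (∈-∃++; ∈-resp-≈; ∈-map⁺; ∈-map⁻)
open import Data.List.Relation.Unary.Unique.Setoid.Properties as Unique
  using (Unique[x∷xs]⇒x∉xs)
import Data.List.Membership.Setoid as Membership
import Data.List.Relation.Unary.Unique.Setoid as UniqueSetoid
import Data.List.Relation.Binary.Permutation.Setoid as PermutationSetoid
import Data.List.Relation.Binary.Permutation.Setoid.Properties as PermutationProps
open import Data.Empty using (⊥-elim)
open import Relation.Nullary using (¬_; yes; no)
open import Relation.Binary.Bundles using (Setoid)
import Relation.Binary.PropositionalEquality as ≡
open import Algebra.Bundles using (CommutativeMonoid)

module _ {a ℓ : Level} (S : Setoid a ℓ) where
  open Setoid S
  open Membership S using (_∈_)
  open UniqueSetoid S using (Unique)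
  open PermutationSetoid S using (_↭_; prep; ↭-refl; ↭-sym; ↭-trans; ↭-reflexive-≋)
  open PermutationProps S using (↭-shift; ∈-resp-↭; Unique-resp-↭)

  unique-sameMembers⇒↭ : ∀ {xs ys} → Unique xs → Unique ys →
                         (∀ {z} → z ∈ xs → z ∈ ys) → (∀ {z} → z ∈ ys → z ∈ xs) →
                         xs ↭ ys
  unique-sameMembers⇒↭ {[]} {[]} _ _ _ _ = ↭-refl
  unique-sameMembers⇒↭ {[]} {y ∷ ys} _ _ _ ys⊆xs with ys⊆xs (here refl)
  ... | ()
  unique-sameMembers⇒↭ {x ∷ xs} {ys} x∷xs! ys! xs⊆ys ys⊆xs
    with ∈-∃++ S (xs⊆ys (here refl))
  ... | as , bs , w , x≈w , ys≋ = ↭-trans (prep x≈w xs↭rest) (↭-sym ys↭w∷rest)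
    where
      ys↭w∷rest : ys ↭ w ∷ as ++ bs
      ys↭w∷rest = ↭-trans (↭-reflexive-≋ ys≋) (↭-shift as bs)

      w∷rest! : Unique (w ∷ as ++ bs)
      w∷rest! = Unique-resp-↭ ys↭w∷rest ys!

      xs⊆rest : ∀ {z} → z ∈ xs → z ∈ as ++ bs
      xs⊆rest z∈xs with ∈-resp-↭ ys↭w∷rest (xs⊆ys (there z∈xs))
      ... | here z≈w = ⊥-elim (Unique[x∷xs]⇒x∉xs S x∷xs!
                                 (∈-resp-≈ S (trans z≈w (sym x≈w)) z∈xs))
      ... | there z∈rest = z∈rest

      rest⊆xs : ∀ {z} → z ∈ as ++ bs → z ∈ xs
      rest⊆xs z∈rest with ys⊆xs (∈-resp-↭ (↭-sym ys↭w∷rest) (there z∈rest))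
      ... | here z≈x = ⊥-elim (Unique[x∷xs]⇒x∉xs S w∷rest!
                                 (∈-resp-≈ S (trans z≈x x≈w) z∈rest))
      ... | there z∈xs = z∈xs

      xs↭rest : xs ↭ as ++ bs
      xs↭rest = unique-sameMembers⇒↭ (AllPairs.tail x∷xs!) (AllPairs.tail w∷rest!)
                                     xs⊆rest rest⊆xs

module _ {a ℓ c ℓ′ : Level} (S : Setoid a ℓ) (M : CommutativeMonoid c ℓ′) where
  open Setoid S using () renaming (Carrier to A; _≈_ to _∼_; refl to ∼-refl)
  open CommutativeMonoid M
  open Membership S using (_∈_)
  open PermutationSetoid S using (_↭_; prep; swap; ↭-sym)
    renaming (refl to ≋⇒↭; trans to ↭-trans)
  open PermutationProps S using (∈-resp-↭)
  open import Data.List.Relation.Binary.Equality.Setoid S using (_≋_)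
  open import Relation.Binary.Reasoning.Setoid setoid

  sumOver : List A → (A → Carrier) → Carrier
  sumOver xs f = foldr (λ x s → f x ∙ s) ε xs

  sumOver-map : ∀ (h : A → A) xs f → sumOver (map h xs) f ≡.≡ sumOver xs (λ x → f (h x))
  sumOver-map h []       f = ≡.refl
  sumOver-map h (x ∷ xs) f = ≡.cong (f (h x) ∙_) (sumOver-map h xs f)

  sumOver-resp-↭ : ∀ (f : A → Carrier) {xs ys} →
                   (∀ {u v} → u ∈ xs → u ∼ v → f u ≈ f v) →
                   xs ↭ ys → sumOver xs f ≈ sumOver ys f
  sumOver-resp-↭ f f-resp (≋⇒↭ xs≋ys) = pointwise f-resp xs≋ys
    where
      pointwise : ∀ {xs ys} → (∀ {u v} → u ∈ xs → u ∼ v → f u ≈ f v) →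
                  xs ≋ ys → sumOver xs f ≈ sumOver ys f
      pointwise _      []           = refl
      pointwise f-resp (x∼y ∷ xs≋ys) =
        ∙-cong (f-resp (here ∼-refl) x∼y) (pointwise (λ u∈ → f-resp (there u∈)) xs≋ys)
  sumOver-resp-↭ f f-resp (prep x∼y xs↭ys) =
    ∙-cong (f-resp (here ∼-refl) x∼y) (sumOver-resp-↭ f (λ u∈ → f-resp (there u∈)) xs↭ys)
  sumOver-resp-↭ f f-resp (swap {xs} {ys} {x} {y} {x′} {y′} x∼x′ y∼y′ xs↭ys) = begin
    f x ∙ (f y ∙ sumOver xs f)    ≈⟨ ∙-congˡ (∙-congˡ (sumOver-resp-↭ f (λ u∈ → f-resp (there (there u∈))) xs↭ys)) ⟩
    f x ∙ (f y ∙ sumOver ys f)    ≈⟨ assoc _ _ _ ⟨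
    (f x ∙ f y) ∙ sumOver ys f    ≈⟨ ∙-congʳ (comm _ _) ⟩
    (f y ∙ f x) ∙ sumOver ys f    ≈⟨ ∙-congʳ (∙-cong (f-resp (there (here ∼-refl)) y∼y′)
                                                    (f-resp (here ∼-refl) x∼x′)) ⟩
    (f y′ ∙ f x′) ∙ sumOver ys f  ≈⟨ assoc _ _ _ ⟩
    f y′ ∙ (f x′ ∙ sumOver ys f)  ∎
  sumOver-resp-↭ f f-resp (↭-trans xs↭ys ys↭zs) = trans
    (sumOver-resp-↭ f f-resp xs↭ys)
    (sumOver-resp-↭ f (λ u∈ys → f-resp (∈-resp-↭ (↭-sym xs↭ys) u∈ys)) ys↭zs)

permSetoid : ℕ → Setoid 0ℓ 0ℓ
permSetoid k = record
  { Carrier       = Permutation′ k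
  ; _≈_           = Perm._≈_
  ; isEquivalence = record
    { refl  = λ _ → ≡.refl
    ; sym   = λ π≈ρ i → ≡.sym (π≈ρ i)
    ; trans = λ π≈ρ ρ≈σ i → ≡.trans (π≈ρ i) (ρ≈σ i)
    }
  }

flip-cong : ∀ {m n} {π ρ : Perm.Permutation m n} → π Perm.≈ ρ → flip π Perm.≈ flip ρ
flip-cong {π = π} {ρ} π≈ρ i = begin
  π ⟨$⟩ˡ i                  ≡⟨ ≡.cong (π ⟨$⟩ˡ_) (inverseʳ ρ) ⟨
  π ⟨$⟩ˡ (ρ ⟨$⟩ʳ (ρ ⟨$⟩ˡ i)) ≡⟨ ≡.cong (π ⟨$⟩ˡ_) (π≈ρ (ρ ⟨$⟩ˡ i)) ⟨
  π ⟨$⟩ˡ (π ⟨$⟩ʳ (ρ ⟨$⟩ˡ i)) ≡⟨ inverseˡ π ⟩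
  ρ ⟨$⟩ˡ i                  ∎
  where open ≡.≡-Reasoning

flip-injective : ∀ {m n} {π ρ : Perm.Permutation m n} → flip π Perm.≈ flip ρ → π Perm.≈ ρ
flip-injective {π = π} {ρ} = flip-cong {π = flip π} {flip ρ}

module _ {k : ℕ} where
  open Membership (permSetoid k) using (_∈_)

  ∈ₚ⇒∈ : ∀ {g xs} → g ∈ₚ xs → g ∈ xs
  ∈ₚ⇒∈ = Any.map (λ h≈g i → ≡.sym (h≈g i))

  ∈⇒∈ₚ : ∀ {g xs} → g ∈ xs → g ∈ₚ xs
  ∈⇒∈ₚ = Any.map (λ g≈h i → ≡.sym (g≈h i))

module _ {k : ℕ} (G : Subgroup k) where
  open Subgroup G
  open Membership (permSetoid k) using (_∈_)
  open PermutationSetoid (permSetoid k) using (_↭_; ↭-sym)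

  flip-elems↭elems : map flip elems ↭ elems
  flip-elems↭elems = unique-sameMembers⇒↭ (permSetoid k)
    (Unique.map⁺ (permSetoid k) (permSetoid k) (λ {π} {ρ} → flip-injective {π = π} {ρ}) nodup) nodup
    (λ {g} → flip-elems⊆elems {g}) (λ {g} → elems⊆flip-elems {g})
    where
      flip-elems⊆elems : ∀ {g} → g ∈ map flip elems → g ∈ elems
      flip-elems⊆elems {g} g∈ with ∈-map⁻ (permSetoid k) (permSetoid k) {v = g} {f = flip} g∈
      ... | h , h∈ , g≈h⁻¹ = ∈-resp-≈ (permSetoid k) {x = flip h} {g} (λ i → ≡.sym (g≈h⁻¹ i))
                               (∈ₚ⇒∈ {g = flip h} (closed⁻ {h} (∈⇒∈ₚ {g = h} h∈)))

      elems⊆flip-elems : ∀ {g} → g ∈ elems → g ∈ map flip elems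
      elems⊆flip-elems {g} g∈ =
        ∈-map⁺ (permSetoid k) (permSetoid k) (λ {π} {ρ} → flip-cong {π = π} {ρ}) {v = flip g}
          (∈ₚ⇒∈ {g = flip g} (closed⁻ {g} (∈⇒∈ₚ {g = g} g∈)))

  module _ {c ℓ′ : Level} (M : CommutativeMonoid c ℓ′) where
    open CommutativeMonoid M
    open import Relation.Binary.Reasoning.Setoid setoid

    sumOver-flip : ∀ (f : Permutation′ k → Carrier) →
                   (∀ {g h} → g ∈ₚ elems → g Perm.≈ h → f g ≈ f h) →
                   sumOver (permSetoid k) M elems (λ g → f (flip g)) ≈ sumOver (permSetoid k) M elems f
    sumOver-flip f f-resp = begin
      sumOver (permSetoid k) M elems (λ g → f (flip g)) ≡⟨ sumOver-map (permSetoid k) M flip elems f ⟨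
      sumOver (permSetoid k) M (map flip elems) f       ≈⟨ sumOver-resp-↭ (permSetoid k) M f f-resp′
                                                             (↭-sym flip-elems↭elems) ⟨
      sumOver (permSetoid k) M elems f                  ∎
      where
        f-resp′ : ∀ {g h} → g ∈ elems → g Perm.≈ h → f g ≈ f h
        f-resp′ {g} {h} g∈ = f-resp {g} {h} (∈⇒∈ₚ {g = g} g∈)

module _ {c ℓ : Level} (F : ACF₀ c ℓ) where
  open ACF₀ F
  open import Relation.Binary.Reasoning.Setoid setoid

  ΣFin-cong : ∀ n {f g : Fin n → Carrier} → (∀ i → f i ≈ g i) → ΣFin F n f ≈ ΣFin F n g
  ΣFin-cong ℕ.zero    f≈g = refl
  ΣFin-cong (ℕ.suc n) f≈g = +-cong (f≈g Fin.zero) (ΣFin-cong n (λ i → f≈g (Fin.suc i)))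

  ΠFin-cong : ∀ n {f g : Fin n → Carrier} → (∀ i → f i ≈ g i) → ΠFin F n f ≈ ΠFin F n g
  ΠFin-cong ℕ.zero    f≈g = refl
  ΠFin-cong (ℕ.suc n) f≈g = *-cong (f≈g Fin.zero) (ΠFin-cong n (λ i → f≈g (Fin.suc i)))

  trace-idM : ∀ d → trace F (idM F {d}) ≈ ℕ→K d
  trace-idM d = trans (ΣFin-cong d idM-diagonal) (ΣFin-1# d)
    where
      idM-diagonal : ∀ i → idM F i i ≈ 1#
      idM-diagonal i with i ≟ i
      ... | yes _  = refl
      ... | no i≢i = ⊥-elim (i≢i ≡.refl)

      ΣFin-1# : ∀ d → ΣFin F d (λ _ → 1#) ≈ ℕ→K d
      ΣFin-1# ℕ.zero    = refl
      ΣFin-1# (ℕ.suc d) = +-congˡ (ΣFin-1# d)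

  inv-l : ∀ {x} → ¬ x ≈ 0# → inv x * x ≈ 1#
  inv-l {x} x≉0 = trans (*-comm (inv x) x) (inv-r x x≉0)

  inv≉0 : ∀ {x} → ¬ x ≈ 0# → ¬ inv x ≈ 0#
  inv≉0 {x} x≉0 inv-x≈0 = 1≉0 (begin
    1#          ≈⟨ inv-r x x≉0 ⟨
    x * inv x   ≈⟨ *-congˡ inv-x≈0 ⟩
    x * 0#      ≈⟨ zeroʳ x ⟩
    0#          ∎)

  *≉0 : ∀ {x y} → ¬ x ≈ 0# → ¬ y ≈ 0# → ¬ x * y ≈ 0#
  *≉0 {x} {y} x≉0 y≉0 xy≈0 = y≉0 (begin
    y                ≈⟨ *-identityˡ y ⟨
    1# * y           ≈⟨ *-congʳ (inv-l x≉0) ⟨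
    (inv x * x) * y  ≈⟨ *-assoc (inv x) x y ⟩
    inv x * (x * y)  ≈⟨ *-congˡ xy≈0 ⟩
    inv x * 0#       ≈⟨ zeroʳ (inv x) ⟩
    0#               ∎)

  ℕ→K-length≉0 : ∀ {a p} {A : Set a} {P : A → Set p} {xs : List A} →
                 Any P xs → ¬ ℕ→K (length xs) ≈ 0#
  ℕ→K-length≉0 {xs = x ∷ xs} _ = char0 (length xs)

  module _ {n k : ℕ} where
    SameProjPoint-sym : {T U : Tensor F n k} → SameProjPoint F T U → SameProjPoint F U T
    SameProjPoint-sym {T} {U} (s , s≉0 , T≈sU) = inv s , inv≉0 s≉0 , λ z → begin
      U z                 ≈⟨ *-identityˡ (U z) ⟨
      1# * U z            ≈⟨ *-congʳ (inv-l s≉0) ⟨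
      (inv s * s) * U z   ≈⟨ *-assoc (inv s) s (U z) ⟩
      inv s * (s * U z)   ≈⟨ *-congˡ (T≈sU z) ⟨
      inv s * T z         ∎

    SameProjPoint-trans : {T U V : Tensor F n k} → SameProjPoint F T U → SameProjPoint F U V →
                          SameProjPoint F T V
    SameProjPoint-trans {T} {U} {V} (s , s≉0 , T≈sU) (t , t≉0 , U≈tV) =
      s * t , *≉0 s≉0 t≉0 , λ z → begin
        T z             ≈⟨ T≈sU z ⟩
        s * U z         ≈⟨ *-congˡ (U≈tV z) ⟩
        s * (t * V z)   ≈⟨ *-assoc s t (V z) ⟨
        (s * t) * V z   ∎

    IsZeroT-resp : {T U : Tensor F n k} → SameProjPoint F T U → IsZeroT F U → IsZeroT F T
    IsZeroT-resp {T} {U} (s , _ , T≈sU) U≈0 z = begin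
      T z       ≈⟨ T≈sU z ⟩
      s * U z   ≈⟨ *-congˡ (U≈0 z) ⟩
      s * 0#    ≈⟨ zeroʳ s ⟩
      0#        ∎

  module _ {k : ℕ} (G : Subgroup k) {χ : Permutation′ k → Carrier} where
    open Subgroup G

    χ-resp : IsSimpleCharacter F G χ → ∀ {g h} → g ∈ₚ elems → g Perm.≈ h → χ g ≈ χ h
    χ-resp (d , ρ , ρ-rep , _ , χ≈trρ) {g} {h} g∈G g≈h = begin
      χ g            ≈⟨ χ≈trρ g∈G ⟩
      trace F (ρ g)  ≈⟨ ΣFin-cong d (λ i → IsRep.rep-resp ρ-rep g∈G g≈h i i) ⟩
      trace F (ρ h)  ≈⟨ χ≈trρ h∈G ⟨
      χ h            ∎
      where h∈G = Any.map (λ {x} x≈g i → ≡.trans (x≈g i) (g≈h i)) g∈G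

    -- χ(e) is the degree of ρ, a positive integer.
    χ-id≉0 : IsSimpleCharacter F G χ → ¬ χ idₚ ≈ 0#
    χ-id≉0 (ℕ.zero  , _ , _ , (() , _) , _)
    χ-id≉0 (ℕ.suc d , ρ , ρ-rep , _ , χ≈trρ) χ-id≈0 = char0 d (begin
      ℕ→K (ℕ.suc d)              ≈⟨ trace-idM (ℕ.suc d) ⟨
      trace F (idM F {ℕ.suc d})  ≈⟨ ΣFin-cong (ℕ.suc d) (λ i → IsRep.rep-id ρ-rep i i) ⟨
      trace F (ρ idₚ)            ≈⟨ χ≈trρ has-id ⟨
      χ idₚ                      ≈⟨ χ-id≈0 ⟩
      0#                         ∎)

    Pχ-simpleTensor∼param : IsSimpleCharacter F G χ → ∀ {n} (A : Mat F n k) →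
                            SameProjPoint F (Pχ F G χ (simpleTensor F A)) (param F G χ A)
    Pχ-simpleTensor∼param χ-simple {n} A =
      χ idₚ * inv (ℕ→K order) , *≉0 (χ-id≉0 χ-simple) (inv≉0 (ℕ→K-length≉0 has-id)) ,
      λ z → *-congˡ (sumOver-flip G +-commutativeMonoid (term z) (term-resp z))
      where
        -- The g-th summand of P_χ(T_A) at z is definitionally term z (flip g).
        term : Index F n k → Permutation′ k → Carrier
        term z g = χ g * tensorPowEntry F A (actIdx F g z) (λ i → i)

        term-resp : ∀ z {g h} → g ∈ₚ elems → g Perm.≈ h → term z g ≈ term z h
        term-resp z {g} {h} g∈G g≈h = *-cong (χ-resp χ-simple g∈G g≈h)
          (ΠFin-cong k (λ i → reflexive (≡.cong (λ j → A (z j) i) (flip-cong {π = g} {h} g≈h i))))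

theorem3p16 : ∀ {c ℓ : Level} (F : ACF₀ c ℓ) (k n : ℕ) → 0 < k → 0 < n →
              (G : Subgroup k) (χ : Permutation′ k → ACF₀.Carrier F) →
              IsSimpleCharacter F G χ →
              ∀ (T : Tensor F n k) →
                (InImage F G χ T → InParamSet F G χ T) ×
                (InParamSet F G χ T → InImage F G χ T)
theorem3p16 F k n _ _ G χ χ-simple T = image⇒param , param⇒image
  where
    P∼param : ∀ (A : Mat F n k) →
              SameProjPoint F (Pχ F G χ (simpleTensor F A)) (param F G χ A)
    P∼param = Pχ-simpleTensor∼param F G χ-simple

    image⇒param : InImage F G χ T → InParamSet F G χ T
    image⇒param (A , A-cols≉0 , P≉0 , T∼P) =
      A , A-cols≉0 , (λ param≈0 → P≉0 (IsZeroT-resp F (P∼param A) param≈0)) ,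
      SameProjPoint-trans F T∼P (P∼param A)

    param⇒image : InParamSet F G χ T → InImage F G χ T
    param⇒image (A , A-cols≉0 , param≉0 , T∼param) =
      A , A-cols≉0 , (λ P≈0 → param≉0 (IsZeroT-resp F (SameProjPoint-sym F (P∼param A)) P≈0)) ,
      SameProjPoint-trans F T∼param (SameProjPoint-sym F (P∼param A))
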